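{- Let $(S,\circ,BB)$ be an Assembly Space and let $\mathscr{O}\in S$ be Binary Decomposable, with $s(\mathscr{O})=2^{n_1}+2^{n_2}+\cdots+2^{n_H}$, $n_1>n_2>\cdots>n_H\ge 0$, $H=H(s(\mathscr{O}))$. Then \[ a(\mathscr{O})\;\le\;\big(H-1\big)+\sum_{i=1}^{n_1}\min\Big\{\sum_{j=1}^{H}\big\lfloor 2^{\,n_j-i}\big\rfloor,\ \mathrm{Card}\big(S(2^i)\big)\Big\}. \]
   Context: A Multi-Magma $(S,\circ)$ is a set $S$ together with a binary operation $\circ:2^S\times 2^S\to 2^S$, extended element-wise: for $A,A'\subseteq S$, $A\circ A'=\bigcup_{x\in A,\,y\in A'}\{x\}\circ\{y\}$. A subset $BB\subseteq S$ is fixed as the set of Building Blocks. Assembly Addition Chains: for $\mathscr{O}\in S\setminus BB$, an AAC of $\mathscr{O}$ is a finite sequence $(\mathscr{O}_1,\dots,\mathscr{O}_r)$ of elements of $S$ with $\mathscr{O}_r=\mathscr{O}$, $\mathscr{O}_1\in\{\mathscr{B}\}\circ\{\mathscr{B}'\}$ for some $\mathscr{B},\mathscr{B}'\in BB$, and for each $\rho\in\{2,\dots,r\}$ there exist $\mathscr{O}_\sigma,\mathscr{O}_\tau\in\{\mathscr{O}_1,\dots,\mathscr{O}_{\rho-1}\}\cup BB$ with $\mathscr{O}_\rho\in\{\mathscr{O}_\sigma\}\circ\{\mathscr{O}_\tau\}$. Its length is $r$. Assembly Multi-Magma: for every $\mathscr{O}\in S\setminus BB$: (1) there exist $\mathscr{B}_0,\dots,\mathscr{B}_r\in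 BB$ and an AAC $\Gamma(\mathscr{O})=(\mathscr{O}_1,\dots,\mathscr{O}_r=\mathscr{O})$ with $\mathscr{O}_1\in\{\mathscr{B}_0\}\circ\{\mathscr{B}_1\}$, $\mathscr{O}_i\in\{\mathscr{O}_{i-1}\}\circ\{\mathscr{B}_i\}$ ($i\ge 2$); (2) any other such chain from blocks $\overline{\mathscr{B}}_0,\dots,\overline{\mathscr{B}}_s$ has $s=r$ and the blocks are a permutation of the $\mathscr{B}_i$. Size: $s(\mathscr{O})=1$ for $\mathscr{O}\in BB$, $s(\mathscr{O})=r+1$ otherwise. Assembly Space: additionally $s(\mathscr{O})=s(\mathscr{O}_\sigma)+s(\mathscr{O}_\tau)$ whenever $\mathscr{O}\in S\setminus BB$ and $\mathscr{O}\in\{\mathscr{O}_\sigma\}\circ\{\mathscr{O}_\tau\}$. Assembly Index: $a(\mathscr{O})=0$ for $\mathscr{O}\in BB$, otherwise the minimal length of an AAC of $\mathscr{O}$. $S(k)=\{\mathscr{O}\in S: s(\mathscr{O})=k\}$, $\mathrm{Card}$ denotes cardinality, and $H(k)$ is the Hamming weight (number of 1's in the binary expansion) of $k$. Balanced products: for $\mathscr{B}_1,\dots,\mathscr{B}_{2^m}\in BB$ define $T(\mathscr{B}_1)=\{\mathscr{B}_1\}$ and, for $m\ge1$, $T(\mathscr{B}_1,\dots,\mathscr{B}_{2^m})=T(\mathscr{B}_1,\dots,\mathscr{B}_{2^{m-1}})\circ T(\mathscr{B}_{2^{m-1}+1},\dots,\mathscr{B}_{2^m})$. Binary Decomposable objects: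 with $s(\mathscr{O})=2^{n_1}+\cdots+2^{n_H}$, $n_1>\cdots>n_H\ge0$, $\mathscr{O}$ is Binary Decomposable if there exist building blocks $\mathscr{B}^{(i)}_j\in BB$ ($i=1,\dots,H$, $j=1,\dots,2^{n_i}$) and objects $\mathscr{P}_i\in T(\mathscr{B}^{(i)}_1,\dots,\mathscr{B}^{(i)}_{2^{n_i}})$ such that $\mathscr{O}\in\{\mathscr{P}_H\}\circ\big(\cdots\circ(\{\mathscr{P}_3\}\circ(\{\mathscr{P}_2\}\circ\{\mathscr{P}_1\}))\cdots\big)$ (for $H=1$ this means $\mathscr{O}=\mathscr{P}_1$). -}

module Defs where

open import Level using (Level; _⊔_) renaming (suc to lsuc)
open import Data.Nat using (ℕ; zero; suc; _+_; _∸_; _^_; _≤_; _<_; _>_; _≤ᵇ_)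
open import Data.Nat.Properties using (+-identityʳ)
open import Data.Bool using (if_then_else_)
open import Data.Fin using (Fin)
open import Data.List using (List; []; _∷_; length; map; reverse; upTo)
open import Data.Nat.ListAction using (sum)
open import Data.List.Membership.Propositional using (_∈_)
open import Data.List.Relation.Binary.Permutation.Propositional using (_↭_)
open import Data.Vec using (Vec; []; _∷_; take; drop; cast)
open import Data.Vec.Relation.Unary.All using (All)
open import Data.Product using (Σ; ∃; ∃-syntax; _×_; _,_)
open import Data.Sum using (_⊎_)
open import Data.Empty using (⊥)
open import Relation.Nullary using (¬_)
open import Relation.Binary.PropositionalEquality using (_≡_)
open import Function.Bundles using (_↣_)

-- Multi-magma data: a carrier S, the element-level product
-- Prod x y z  meaning  z ∈ {x} ∘ {y}   (the extension to subsets is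
-- the union, so A ∘ A' ∋ z  iff  ∃ x ∈ A, y ∈ A', Prod x y z),
-- and the predicate BB of building blocks.

module _ {a ℓ ℓ' : Level} {S : Set a}
         (Prod : S → S → S → Set ℓ) (BB : S → Set ℓ') where

  -- Linear chains of axiom (1):  Lin O bs  means O = O_r is obtained by
  -- O_1 ∈ {B_0}∘{B_1}, O_i ∈ {O_{i-1}}∘{B_i}; bs lists the blocks
  -- B_r, …, B_1, B_0 (so length bs = r + 1).
  data Lin : S → List S → Set (a ⊔ ℓ ⊔ ℓ') where
    start : ∀ {b₀ b₁ o} → BB b₀ → BB b₁ → Prod b₀ b₁ o → Lin o (b₁ ∷ b₀ ∷ [])
    step  : ∀ {p b o bs} → Lin p bs → BB b → Prod p b o → Lin o (b ∷ bs)

  Avail : S → List S → Set (a ⊔ ℓ')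
  Avail x ps = BB x ⊎ x ∈ ps

  -- Chain ps : ps = (O_ρ, …, O_1) (most recent first) is a valid prefix of
  -- an assembly addition chain.  For ρ = 1 both factors must be blocks.
  data Chain : List S → Set (a ⊔ ℓ ⊔ ℓ') where
    []  : Chain []
    _∷_ : ∀ {x y o ps} → Chain ps → (Avail x ps × Avail y ps × Prod x y o)
        → Chain (o ∷ ps)

  -- An AAC of O of length r = suc (length cs): the sequence
  -- (O_1, …, O_{r-1}, O) with cs = (O_{r-1}, …, O_1).
  IsAAC : S → List S → Set (a ⊔ ℓ ⊔ ℓ')
  IsAAC O cs = Chain (O ∷ cs)

record AssemblySpace (a ℓ ℓ' : Level) : Set (lsuc (a ⊔ ℓ ⊔ ℓ')) where
  field
    Carrier : Set a
    Prod    : Carrier → Carrier → Carrier → Set ℓ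
    BB      : Carrier → Set ℓ'
    linear-exists : ∀ O → ¬ BB O → ∃[ bs ] Lin Prod BB O bs
    linear-unique : ∀ O → ¬ BB O → ∀ {bs bs'} →
                    Lin Prod BB O bs → Lin Prod BB O bs' → bs ↭ bs'
    size    : Carrier → ℕ
    size-BB  : ∀ {O} → BB O → size O ≡ 1
    size-lin : ∀ {O bs} → ¬ BB O → Lin Prod BB O bs → size O ≡ length bs
    size-additive : ∀ {O x y} → ¬ BB O → Prod x y O → size O ≡ size x + size y

module _ {a ℓ ℓ' : Level} (A : AssemblySpace a ℓ ℓ') where
  open AssemblySpace A

  -- a(O) ≤ m :  a(O) = 0 if O ∈ BB, otherwise the minimal AAC length;
  -- so a(O) ≤ m iff O ∈ BB or some AAC of O has length ≤ m.
  AssemblyIndex≤ : Carrier → ℕ → Set (a ⊔ ℓ ⊔ ℓ')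
  AssemblyIndex≤ O m = BB O ⊎ (∃[ cs ] (IsAAC Prod BB O cs × suc (length cs) ≤ m))

  SizeClass : ℕ → Set a
  SizeClass k = Σ Carrier (λ O → size O ≡ k)

  T : (m : ℕ) → Vec Carrier (2 ^ m) → Carrier → Set (a ⊔ ℓ)
  T zero    (b ∷ []) o = Level.Lift ℓ (o ≡ b)
  T (suc m) v        o =
    ∃[ x ] ∃[ y ] (T m (take (2 ^ m) v) x
                 × T m (cast (+-identityʳ (2 ^ m)) (drop (2 ^ m) v)) y
                 × Prod x y o)

  BalancedOf : ℕ → Carrier → Set (a ⊔ ℓ ⊔ ℓ')
  BalancedOf m P = ∃[ v ] (All BB v × T m v P)

  -- Nested products, list given as (n_H, …, n_1):
  -- Nest (n_1 ∷ []) = objects P_1 ;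
  -- Nest (n_k ∷ rest) ∋ o  iff  o ∈ {P_k} ∘ (Nest rest)
  Nest : List ℕ → Carrier → Set (a ⊔ ℓ ⊔ ℓ')
  Nest []            o = Level.Lift _ ⊥
  Nest (n ∷ [])      o = BalancedOf n o
  Nest (n ∷ m ∷ ms)  o = ∃[ p ] ∃[ q ] (BalancedOf n p × Nest (m ∷ ms) q × Prod p q o)

  -- Binary decomposability w.r.t. the exponent list ns = (n_1, …, n_H)
  -- of the binary expansion of s(O).
  BinaryDecomposable : List ℕ → Carrier → Set (a ⊔ ℓ ⊔ ℓ')
  BinaryDecomposable ns O = Nest (reverse ns) O

  -- "min { c , Card S(2^i) } ≤ k"
  MinCard≤ : ℕ → ℕ → ℕ → Set a
  MinCard≤ c i k = c ≤ k ⊎ (SizeClass (2 ^ i) ↣ Fin k)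

floorPow2 : ℕ → ℕ → ℕ
floorPow2 n i = if i ≤ᵇ n then 2 ^ (n ∸ i) else 0

countAt : List ℕ → ℕ → ℕ
countAt ns i = sum (map (λ n → floorPow2 n i) ns)

sum1to : ℕ → (ℕ → ℕ) → ℕ
sum1to N f = sum (map (λ i → f (suc i)) (upTo N))

{-# OPTIONS --safe #-}
-- Size additivity forces the factor P_i of a binary decomposable object to have size exactly
-- 2^(n_i), and then every node of height i in the balanced tree of P_i to have size 2^i.
-- Assemble all these trees level by level: the nodes of height i are products of nodes of
-- height i - 1, and at most min(Σ_j ⌊2^(n_j - i)⌋, Card S(2^i)) of them are distinct objects,
-- so level i costs at most k i chain steps.  Afterwards every P_i is available and H - 1 further
-- products yield O.
module Submission where

open import Defs
open import Level using (Level; _⊔_; lift)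
open import Data.Nat using (ℕ; zero; suc; _+_; _^_; _≤_; _<_; _>_; _∸_; _≤ᵇ_; z≤n; s≤s; _≟_)
open import Data.Nat.Properties
open import Data.Bool using (true; false; if_then_else_)
open import Data.Fin using (Fin) renaming (_≟_ to _≟ᶠ_)
open import Data.List using (List; []; _∷_; length; map; _++_; reverse; upTo; allFin; mapMaybe)
open import Data.List.Properties using (length-++; length-tabulate; length-mapMaybe; length-reverse; map-++; upTo-∷ʳ)
open import Data.Nat.ListAction using (sum)
open import Data.Nat.ListAction.Properties using (sum-++; sum-↭)
open import Data.List.Membership.Propositional using (_∈_; find; lose)
open import Data.List.Membership.Propositional.Properties using (∈-++⁺ˡ; ∈-++⁺ʳ; ∈-allFin)
open import Data.List.Relation.Binary.Subset.Propositional using (_⊆_)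
open import Data.List.Relation.Binary.Permutation.Propositional using (↭-sym)
open import Data.List.Relation.Binary.Permutation.Propositional.Properties using (↭-reverse; All-resp-↭)
import Data.List.Relation.Binary.Permutation.Propositional.Properties as ↭
open import Data.List.Relation.Unary.Any using (here; there; any?)
import Data.List.Relation.Unary.Any.Properties as Any
open import Data.List.Relation.Unary.All using (All; []; _∷_)
import Data.List.Relation.Unary.All as All
import Data.List.Relation.Unary.All.Properties as All
open import Data.List.Relation.Unary.Linked using (Linked)
import Data.List.Relation.Unary.Linked as Linked
open import Data.List.Relation.Unary.Linked.Properties using (Linked⇒All)
open import Data.Maybe using (Maybe; just; nothing)
import Data.Maybe.Relation.Unary.All as Maybe
import Data.Maybe.Relation.Unary.Any as Maybe
open import Data.Vec using (Vec; []; _∷_; cast)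
open import Data.Vec.Relation.Unary.All as Vec using ([]; _∷_)
import Data.Vec.Relation.Unary.All.Properties as Vec
open import Data.Product using (Σ; ∃-syntax; _×_; _,_; proj₁; proj₂)
open import Data.Sum using (_⊎_; inj₁; inj₂)
open import Function using (id; _∘_)
open import Function.Bundles using (_↣_; Injection)
open import Relation.Nullary using (¬_; yes; no; contradiction)
open import Relation.Nullary.Reflects using (ofʸ; ofⁿ)
open import Relation.Unary using (Pred; Decidable; Irrelevant)
open import Relation.Binary.PropositionalEquality

m+o≡n+p⇒m≡n×o≡p : ∀ {m n o p} → m ≤ n → o ≤ p → m + o ≡ n + p → m ≡ n × o ≡ p
m+o≡n+p⇒m≡n×o≡p {m} {n} {o} {p} m≤n o≤p eq =
  m≡n , +-cancelˡ-≡ n o p (trans (cong (_+ o) (sym m≡n)) eq)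
  where
  m≡n : m ≡ n
  m≡n = ≤-antisym m≤n (+-cancelʳ-≤ p n m (≤-trans (≤-reflexive (sym eq)) (+-monoʳ-≤ m o≤p)))

2^m+2^m≡2^[1+m] : ∀ m → 2 ^ m + 2 ^ m ≡ 2 ^ suc m
2^m+2^m≡2^[1+m] m = cong (2 ^ m +_) (sym (+-identityʳ (2 ^ m)))

m∸n≡1+[m∸1+n] : ∀ {m n} → n < m → m ∸ n ≡ suc (m ∸ suc n)
m∸n≡1+[m∸1+n] {m} n<m = +-∸-assoc 1 {m} n<m

sum1to-suc : ∀ n f → sum1to (suc n) f ≡ sum1to n f + f (suc n)
sum1to-suc n f = begin
  sum (map g (upTo (suc n)))              ≡⟨ cong (sum ∘ map g) (sym (upTo-∷ʳ n)) ⟩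
  sum (map g (upTo n ++ n ∷ []))          ≡⟨ cong sum (map-++ g (upTo n) (n ∷ [])) ⟩
  sum (map g (upTo n) ++ g n ∷ [])        ≡⟨ sum-++ (map g (upTo n)) (g n ∷ []) ⟩
  sum1to n f + (f (suc n) + 0)            ≡⟨ cong (sum1to n f +_) (+-identityʳ (f (suc n))) ⟩
  sum1to n f + f (suc n)                  ∎
  where
  open ≡-Reasoning
  g : ℕ → ℕ
  g i = f (suc i)

Vec-All-cast⁺ : ∀ {a p} {A : Set a} {P : A → Set p} {m n} .(eq : m ≡ n) {xs : Vec A m} →
                Vec.All P xs → Vec.All P (cast eq xs)
Vec-All-cast⁺ {n = zero}  eq []         = []
Vec-All-cast⁺ {n = suc _} eq (px ∷ pxs) = px ∷ Vec-All-cast⁺ _ pxs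

-- Keeps one element of xs per code in Fin K; irrelevance of P makes the code of y independent of
-- the proof of P y.
module Representatives {x p} {X : Set x} {P : Pred X p} (P? : Decidable P) (P-irrelevant : Irrelevant P)
                       {K : ℕ} (f : Σ X P ↣ Fin K) where
  open Injection f using (to; injective)

  HasCode : Fin K → Pred X p
  HasCode c y = Σ (P y) λ py → to (y , py) ≡ c

  hasCode? : ∀ c → Decidable (HasCode c)
  hasCode? c y with P? y
  ... | no ¬py = no (¬py ∘ proj₁)
  ... | yes py with to (y , py) ≟ᶠ c
  ...   | yes eq = yes (py , eq)
  ...   | no neq = no λ (py′ , eq) → neq (trans (cong (λ q → to (y , q)) (P-irrelevant py py′)) eq)

  pick : List X → Fin K → Maybe X
  pick xs c with any? (hasCode? c) xs
  ... | yes has = just (proj₁ (find has))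
  ... | no _    = nothing

  pick-∈ : ∀ xs c → Maybe.All (_∈ xs) (pick xs c)
  pick-∈ xs c with any? (hasCode? c) xs
  ... | yes has = Maybe.just (proj₁ (proj₂ (find has)))
  ... | no _    = Maybe.nothing

  pick-code : ∀ {xs y} → y ∈ xs → (py : P y) → Maybe.Any (y ≡_) (pick xs (to (y , py)))
  pick-code {xs} {y} y∈xs py with any? (hasCode? (to (y , py))) xs
  ... | yes has = let (_ , _ , _ , eq) = find has in Maybe.just (sym (cong proj₁ (injective eq)))
  ... | no ¬has = contradiction (lose y∈xs (py , refl)) ¬has

  representatives : List X → List X
  representatives xs = mapMaybe (pick xs) (allFin K)

  representatives-length : ∀ xs → length (representatives xs) ≤ K
  representatives-length xs =
    ≤-trans (length-mapMaybe (pick xs) (allFin K)) (≤-reflexive (length-tabulate id))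

  representatives-⊆ : ∀ xs → representatives xs ⊆ xs
  representatives-⊆ xs = All.lookup (All.mapMaybe⁺ (All.map⁺ (All.universal (pick-∈ xs) (allFin K))))

  ⊆-representatives : ∀ {xs} → All P xs → xs ⊆ representatives xs
  ⊆-representatives {xs} pxs {y} y∈xs =
    Any.mapMaybe⁺ (pick xs) (allFin K)
      (Any.map⁺ (lose {P = λ c → Maybe.Any (y ≡_) (pick xs c)} (∈-allFin _)
                      (pick-code y∈xs (All.lookup pxs y∈xs))))

module Chains {a ℓ ℓ′} {S : Set a} (Prod : S → S → S → Set ℓ) (BB : S → Set ℓ′) where

  ProductOf : ∀ {p} → Pred S p → Pred S (a ⊔ ℓ ⊔ p)
  ProductOf P o = ∃[ x ] ∃[ y ] (P x × P y × Prod x y o)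

  ProductOf-map : ∀ {p q} {P : Pred S p} {Q : Pred S q} → (∀ {x} → P x → Q x) →
                  ∀ {o} → ProductOf P o → ProductOf Q o
  ProductOf-map f (x , y , px , py , prod) = x , y , f px , f py , prod

  Lin⇒length≢0 : ∀ {o bs} → Lin Prod BB o bs → length bs ≢ 0
  Lin⇒length≢0 (start _ _ _) ()
  Lin⇒length≢0 (step _ _ _)  ()

  Avail-++⁺ : ∀ {x ps} qs → Avail Prod BB x ps → Avail Prod BB x (qs ++ ps)
  Avail-++⁺ qs (inj₁ block) = inj₁ block
  Avail-++⁺ qs (inj₂ x∈ps)  = inj₂ (∈-++⁺ʳ qs x∈ps)

  Chain-++ : ∀ {ps qs} → Chain Prod BB ps → All (ProductOf (λ x → Avail Prod BB x ps)) qs →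
             Chain Prod BB (qs ++ ps)
  Chain-++ chain [] = chain
  Chain-++ {qs = _ ∷ qs} chain ((_ , _ , ax , ay , prod) ∷ rest) =
    Chain-++ chain rest ∷ (Avail-++⁺ qs ax , Avail-++⁺ qs ay , prod)

  Chain-∈⇒AAC : ∀ {ps x} → Chain Prod BB ps → x ∈ ps →
                ∃[ cs ] (IsAAC Prod BB x cs × suc (length cs) ≤ length ps)
  Chain-∈⇒AAC {_ ∷ ps} chain (here refl) = ps , chain , ≤-refl
  Chain-∈⇒AAC (chain ∷ _) (there x∈ps) =
    let (cs , aac , len) = Chain-∈⇒AAC chain x∈ps in cs , aac , m≤n⇒m≤1+n len

module _ {a ℓ ℓ′ : Level} (A : AssemblySpace a ℓ ℓ′) where
  open AssemblySpace A
  open Chains Prod BB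

  Chain⇒AssemblyIndex≤ : ∀ {ps O n} → Chain Prod BB ps → Avail Prod BB O ps → length ps ≤ n →
                         AssemblyIndex≤ A O n
  Chain⇒AssemblyIndex≤ chain (inj₁ block) _ = inj₁ block
  Chain⇒AssemblyIndex≤ chain (inj₂ O∈ps) len =
    let (cs , aac , len′) = Chain-∈⇒AAC chain O∈ps in inj₂ (cs , aac , ≤-trans len′ len)

  0<size : ∀ O → 0 < size O
  0<size O = n≢0⇒n>0 λ size≡0 →
    let ¬block : ¬ BB O
        ¬block block = 1+n≢0 (trans (sym (size-BB block)) size≡0)
        (_ , lin) = linear-exists O ¬block
    in Lin⇒length≢0 lin (trans (sym (size-lin ¬block lin)) size≡0)

  -- BB is undecidable, so split on size o ≟ 1 instead: an object of size ≠ 1 is no block.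
  size-Prod-≤ : ∀ {x y o} → Prod x y o → size o ≤ size x + size y
  size-Prod-≤ {x} {y} {o} prod with size o ≟ 1
  ... | yes size≡1 = ≤-trans (≤-reflexive size≡1) (≤-trans (0<size x) (m≤m+n (size x) (size y)))
  ... | no size≢1  = ≤-reflexive (size-additive (size≢1 ∘ size-BB) prod)

  size-Prod-tight : ∀ {x y o m n} → Prod x y o → size x ≤ m → size y ≤ n → size o ≡ m + n →
                    size x ≡ m × size y ≡ n
  size-Prod-tight {x} {y} {o} {m} {n} prod x≤m y≤n o≡m+n =
    m+o≡n+p⇒m≡n×o≡p x≤m y≤n (trans (sym (size-additive ¬block prod)) o≡m+n)
    where
    2≤m+n : 2 ≤ m + n
    2≤m+n = +-mono-≤ (≤-trans (0<size x) x≤m) (≤-trans (0<size y) y≤n)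
    ¬block : ¬ BB o
    ¬block block = <⇒≱ 2≤m+n (≤-reflexive (trans (sym o≡m+n) (size-BB block)))

  data Balanced : ℕ → Carrier → Set (a ⊔ ℓ ⊔ ℓ′) where
    leaf : ∀ {b} → BB b → Balanced zero b
    node : ∀ {m x y o} → Balanced m x → Balanced m y → Prod x y o → Balanced (suc m) o

  balanced : ∀ m {o} → BalancedOf A m o → Balanced m o
  balanced zero    (_ ∷ [] , block ∷ [] , lift refl)     = leaf block
  balanced (suc m) (_ , blocks , _ , _ , tx , ty , prod) =
    node (balanced m (_ , Vec.take⁺ (2 ^ m) blocks , tx))
         (balanced m (_ , Vec-All-cast⁺ _ (Vec.drop⁺ (2 ^ m) blocks) , ty))
         prod

  Balanced-size-≤ : ∀ {m o} → Balanced m o → size o ≤ 2 ^ m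
  Balanced-size-≤ (leaf block) = ≤-reflexive (size-BB block)
  Balanced-size-≤ {suc m} (node l r prod) = begin
    size _          ≤⟨ size-Prod-≤ prod ⟩
    size _ + size _ ≤⟨ +-mono-≤ (Balanced-size-≤ l) (Balanced-size-≤ r) ⟩
    2 ^ m + 2 ^ m   ≡⟨ 2^m+2^m≡2^[1+m] m ⟩
    2 ^ suc m       ∎
    where open ≤-Reasoning

  atDepth : ∀ {m o} → Balanced m o → ℕ → List Carrier
  atDepth {o = o} _ zero       = o ∷ []
  atDepth (leaf _)     (suc d) = []
  atDepth (node l r _) (suc d) = atDepth l d ++ atDepth r d

  atDepth-length : ∀ {m o} (t : Balanced m o) {d} → d ≤ m → length (atDepth t d) ≡ 2 ^ d
  atDepth-length t {zero} _ = refl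
  atDepth-length (node l r _) {suc d} (s≤s d≤m) = begin
    length (atDepth l d ++ atDepth r d)         ≡⟨ length-++ (atDepth l d) ⟩
    length (atDepth l d) + length (atDepth r d) ≡⟨ cong₂ _+_ (atDepth-length l d≤m) (atDepth-length r d≤m) ⟩
    2 ^ d + 2 ^ d                               ≡⟨ 2^m+2^m≡2^[1+m] d ⟩
    2 ^ suc d                                   ∎
    where open ≡-Reasoning

  atDepth-products : ∀ {m o} (t : Balanced m o) {d} → d < m →
                     All (ProductOf (_∈ atDepth t (suc d))) (atDepth t d)
  atDepth-products (node {x = x} {y} _ _ prod) {zero} _ =
    (x , y , here refl , there (here refl) , prod) ∷ []
  atDepth-products (node l r _) {suc d} (s≤s d<m) =
    All.++⁺ (All.map (ProductOf-map ∈-++⁺ˡ) (atDepth-products l d<m))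
            (All.map (ProductOf-map (∈-++⁺ʳ _)) (atDepth-products r d<m))

  atDepth-leaves : ∀ {m o} (t : Balanced m o) → All BB (atDepth t m)
  atDepth-leaves (leaf block) = block ∷ []
  atDepth-leaves (node l r _) = All.++⁺ (atDepth-leaves l) (atDepth-leaves r)

  atDepth-size : ∀ {m o} (t : Balanced m o) → size o ≡ 2 ^ m → ∀ d →
                 All (λ x → size x ≡ 2 ^ (m ∸ d)) (atDepth t d)
  atDepth-size t exact zero = exact ∷ []
  atDepth-size (leaf _) exact (suc d) = []
  atDepth-size {suc m} (node l r prod) exact (suc d) =
    let (l-exact , r-exact) = size-Prod-tight prod (Balanced-size-≤ l) (Balanced-size-≤ r)
                                (trans exact (sym (2^m+2^m≡2^[1+m] m)))
    in All.++⁺ (atDepth-size l l-exact d) (atDepth-size r r-exact d)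

  -- Written like floorPow2, so that its length is computed by the same case split.
  atHeight : ∀ {m o} → Balanced m o → ℕ → List Carrier
  atHeight {m} t i = if i ≤ᵇ m then atDepth t (m ∸ i) else []

  atHeight-length : ∀ {m o} (t : Balanced m o) i → length (atHeight t i) ≡ floorPow2 m i
  atHeight-length {m} t i with i ≤ᵇ m
  ... | true  = atDepth-length t (m∸n≤m m i)
  ... | false = refl

  atHeight-products : ∀ {m o} (t : Balanced m o) i →
                      All (ProductOf (_∈ atHeight t i)) (atHeight t (suc i))
  atHeight-products {m} t i with suc i ≤ᵇ m | ≤ᵇ-reflects-≤ (suc i) m | i ≤ᵇ m | ≤ᵇ-reflects-≤ i m
  ... | false | _       | _     | _        = []
  ... | true  | ofʸ i<m | false | ofⁿ i≰m = contradiction (<⇒≤ i<m) i≰m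
  ... | true  | ofʸ i<m | true  | _ rewrite m∸n≡1+[m∸1+n] i<m =
    atDepth-products t (∸-monoʳ-< (s≤s z≤n) i<m)

  atHeight-size : ∀ {m o} (t : Balanced m o) → size o ≡ 2 ^ m → ∀ i →
                  All (λ x → size x ≡ 2 ^ i) (atHeight t i)
  atHeight-size {m} t exact i with i ≤ᵇ m | ≤ᵇ-reflects-≤ i m
  ... | false | _       = []
  ... | true  | ofʸ i≤m = subst (λ e → All (λ x → size x ≡ 2 ^ e) (atDepth t (m ∸ i)))
                                (m∸[m∸n]≡n i≤m) (atDepth-size t exact (m ∸ i))

  atHeight-root : ∀ {m o} (t : Balanced m o) → o ∈ atHeight t m
  atHeight-root {m} t with m ≤ᵇ m | ≤ᵇ-reflects-≤ m m
  ... | false | ofⁿ m≰m = contradiction ≤-refl m≰m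
  ... | true  | _ rewrite n∸n≡0 m = here refl

  record Tree : Set (a ⊔ ℓ ⊔ ℓ′) where
    constructor tree
    field
      {height} : ℕ
      {root}   : Carrier
      shape    : Balanced height root
  open Tree

  Exact : Tree → Set
  Exact τ = size (root τ) ≡ 2 ^ height τ

  forestAt : List Tree → ℕ → List Carrier
  forestAt []       i = []
  forestAt (τ ∷ τs) i = atHeight (shape τ) i ++ forestAt τs i

  forestAt-length : ∀ τs i → length (forestAt τs i) ≡ countAt (map height τs) i
  forestAt-length []       i = refl
  forestAt-length (τ ∷ τs) i =
    trans (length-++ (atHeight (shape τ) i))
          (cong₂ _+_ (atHeight-length (shape τ) i) (forestAt-length τs i))

  forestAt-products : ∀ τs i → All (ProductOf (_∈ forestAt τs i)) (forestAt τs (suc i))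
  forestAt-products []       i = []
  forestAt-products (τ ∷ τs) i =
    All.++⁺ (All.map (ProductOf-map ∈-++⁺ˡ) (atHeight-products (shape τ) i))
            (All.map (ProductOf-map (∈-++⁺ʳ _)) (forestAt-products τs i))

  forestAt-leaves : ∀ τs → All BB (forestAt τs 0)
  forestAt-leaves []       = []
  forestAt-leaves (τ ∷ τs) = All.++⁺ (atDepth-leaves (shape τ)) (forestAt-leaves τs)

  forestAt-size : ∀ {τs} → All Exact τs → ∀ i → All (λ x → size x ≡ 2 ^ i) (forestAt τs i)
  forestAt-size []                        i = []
  forestAt-size {τ ∷ _} (exact ∷ exacts) i =
    All.++⁺ (atHeight-size (shape τ) exact i) (forestAt-size exacts i)

  forestAt-roots : ∀ τs → All (λ τ → root τ ∈ forestAt τs (height τ)) τs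
  forestAt-roots []       = []
  forestAt-roots (τ ∷ τs) =
    ∈-++⁺ˡ (atHeight-root (shape τ))
      ∷ All.map (λ {τ′} → ∈-++⁺ʳ (atHeight (shape τ) (height τ′))) (forestAt-roots τs)

  components : ∀ ms {q} → Nest A ms q → List Tree
  components (n ∷ [])     bq                   = tree (balanced n bq) ∷ []
  components (n ∷ m ∷ ms) (_ , _ , bp , w , _) = tree (balanced n bp) ∷ components (m ∷ ms) w

  components-heights : ∀ ms {q} (w : Nest A ms q) → map height (components ms w) ≡ ms
  components-heights (n ∷ [])     _                   = refl
  components-heights (n ∷ m ∷ ms) (_ , _ , _ , w , _) = cong (n ∷_) (components-heights (m ∷ ms) w)

  Nest-size-≤ : ∀ ms {q} → Nest A ms q → size q ≤ sum (map (2 ^_) ms)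
  Nest-size-≤ (n ∷ [])     bq =
    ≤-trans (Balanced-size-≤ (balanced n bq)) (≤-reflexive (sym (+-identityʳ _)))
  Nest-size-≤ (n ∷ m ∷ ms) (_ , _ , bp , w , prod) =
    ≤-trans (size-Prod-≤ prod) (+-mono-≤ (Balanced-size-≤ (balanced n bp)) (Nest-size-≤ (m ∷ ms) w))

  components-exact : ∀ ms {q} (w : Nest A ms q) → size q ≡ sum (map (2 ^_) ms) →
                     All Exact (components ms w)
  components-exact (n ∷ [])     _ exact = trans exact (+-identityʳ _) ∷ []
  components-exact (n ∷ m ∷ ms) (_ , _ , bp , w , prod) exact =
    let (p-exact , q-exact) =
          size-Prod-tight prod (Balanced-size-≤ (balanced n bp)) (Nest-size-≤ (m ∷ ms) w) exact
    in p-exact ∷ components-exact (m ∷ ms) w q-exact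

  assemble : ∀ ms {q ps} (w : Nest A ms q) → Chain Prod BB ps →
             All (λ τ → Avail Prod BB (root τ) ps) (components ms w) →
             ∃[ qs ] (Chain Prod BB (qs ++ ps) × Avail Prod BB q (qs ++ ps) × length qs ≤ length ms ∸ 1)
  assemble (n ∷ [])     _ chain (q-avail ∷ []) = [] , chain , q-avail , z≤n
  assemble (n ∷ m ∷ ms) {o} (_ , _ , _ , w , prod) chain (p-avail ∷ avails) =
    let (qs , chain′ , q-avail , len) = assemble (m ∷ ms) w chain avails
    in o ∷ qs , chain′ ∷ (Avail-++⁺ qs p-avail , q-avail , prod) , inj₂ (here refl) , s≤s len

  cover : ∀ {s K} xs → All (λ x → size x ≡ s) xs → length xs ≤ K ⊎ (SizeClass A s ↣ Fin K) →
          ∃[ L ] (L ⊆ xs × xs ⊆ L × length L ≤ K)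
  cover xs _     (inj₁ len≤K) = xs , id , id , len≤K
  cover xs sizes (inj₂ f)     =
    representatives xs , representatives-⊆ xs , ⊆-representatives sizes , representatives-length xs
    where open Representatives (λ x → size x ≟ _) (λ p q → ≡-irrelevant p q) f

  LevelsAvailable : List Tree → ℕ → List Carrier → Set (a ⊔ ℓ′)
  LevelsAvailable τs i ps = ∀ j → j ≤ i → All (λ x → Avail Prod BB x ps) (forestAt τs j)

  module _ (τs : List Tree) (exacts : All Exact τs) (k : ℕ → ℕ) (N : ℕ)
           (k-bound : ∀ i → 1 ≤ i → i ≤ N → MinCard≤ A (length (forestAt τs i)) i (k i)) where

    LevelChain : ℕ → Set (a ⊔ ℓ ⊔ ℓ′)
    LevelChain i = ∃[ ps ] (Chain Prod BB ps × LevelsAvailable τs i ps × length ps ≤ sum1to i k)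

    next-level : ∀ {i} → suc i ≤ N → LevelChain i → LevelChain (suc i)
    next-level {i} i<N (ps , chain , avail , len)
      with cover (forestAt τs (suc i)) (forestAt-size exacts (suc i)) (k-bound (suc i) (s≤s z≤n) i<N)
    ... | L , L⊆ , ⊆L , lenL = L ++ ps , Chain-++ chain products , avail′ , len′
      where
      products : All (ProductOf (λ x → Avail Prod BB x ps)) L
      products = All.tabulate λ x∈L →
        ProductOf-map (All.lookup (avail i ≤-refl)) (All.lookup (forestAt-products τs i) (L⊆ x∈L))

      avail′ : LevelsAvailable τs (suc i) (L ++ ps)
      avail′ j j≤1+i with m≤n⇒m<n∨m≡n j≤1+i
      ... | inj₁ (s≤s j≤i) = All.map (Avail-++⁺ L) (avail j j≤i)
      ... | inj₂ refl      = All.tabulate λ x∈level → inj₂ (∈-++⁺ˡ (⊆L x∈level))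

      len′ : length (L ++ ps) ≤ sum1to (suc i) k
      len′ = begin
        length (L ++ ps)        ≡⟨ trans (length-++ L) (+-comm (length L) (length ps)) ⟩
        length ps + length L    ≤⟨ +-mono-≤ len lenL ⟩
        sum1to i k + k (suc i)  ≡⟨ sym (sum1to-suc i k) ⟩
        sum1to (suc i) k        ∎
        where open ≤-Reasoning

    levelwise-chain : ∀ i → i ≤ N → LevelChain i
    levelwise-chain zero    _   = [] , [] , (λ { zero _ → All.map inj₁ (forestAt-leaves τs) }) , z≤n
    levelwise-chain (suc i) i<N = next-level i<N (levelwise-chain i (<⇒≤ i<N))

  Nest⇒AssemblyIndex≤ : ∀ ms {O} → Nest A ms O → size O ≡ sum (map (2 ^_) ms) →
                        ∀ N → All (_≤ N) ms → ∀ (k : ℕ → ℕ) →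
                        (∀ i → 1 ≤ i → i ≤ N → MinCard≤ A (countAt ms i) i (k i)) →
                        AssemblyIndex≤ A O ((length ms ∸ 1) + sum1to N k)
  Nest⇒AssemblyIndex≤ ms w exact N heights≤N k k-bound =
    let (ps , chain , avail , len) =
          levelwise-chain τs (components-exact ms w exact) k N k-bound′ N ≤-refl
        (qs , chain′ , O-avail , len′) = assemble ms w chain (roots-available avail)
    in Chain⇒AssemblyIndex≤ chain′ O-avail
         (≤-trans (≤-reflexive (length-++ qs)) (+-mono-≤ len′ len))
    where
    τs : List Tree
    τs = components ms w

    heights-≤ : All (λ τ → height τ ≤ N) τs
    heights-≤ = All.map⁻ (subst (All (_≤ N)) (sym (components-heights ms w)) heights≤N)

    k-bound′ : ∀ i → 1 ≤ i → i ≤ N → MinCard≤ A (length (forestAt τs i)) i (k i)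
    k-bound′ i 1≤i i≤N rewrite forestAt-length τs i | components-heights ms w = k-bound i 1≤i i≤N

    roots-available : ∀ {ps} → LevelsAvailable τs N ps → All (λ τ → Avail Prod BB (root τ) ps) τs
    roots-available avail =
      All.zipWith (λ (root∈ , h≤N) → All.lookup (avail _ h≤N) root∈) (forestAt-roots τs , heights-≤)

theorem2 : ∀ {a ℓ ℓ' : Level} (A : AssemblySpace a ℓ ℓ') →
    (O : AssemblySpace.Carrier A) →
    (n₁ : ℕ) (rest : List ℕ) →
    Linked _>_ (n₁ ∷ rest) →
    AssemblySpace.size A O ≡ sum (map (2 ^_) (n₁ ∷ rest)) →
    BinaryDecomposable A (n₁ ∷ rest) O →
    (k : ℕ → ℕ) →
    (∀ i → 1 ≤ i → i ≤ n₁ → MinCard≤ A (countAt (n₁ ∷ rest) i) i (k i)) →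
    AssemblyIndex≤ A O ((length (n₁ ∷ rest) ∸ 1) + sum1to n₁ k)
theorem2 A O n₁ rest decreasing size≡ decomposable k k-bound =
  subst (λ H → AssemblyIndex≤ A O ((H ∸ 1) + sum1to n₁ k)) (length-reverse ns)
    (Nest⇒AssemblyIndex≤ A (reverse ns) decomposable (trans size≡ (sym (sum-reversed (2 ^_))))
      n₁ (All-resp-↭ (↭-sym (↭-reverse ns)) heights≤n₁) k
      (λ i 1≤i i≤n₁ → subst (λ c → MinCard≤ A c i (k i)) (sym (sum-reversed _)) (k-bound i 1≤i i≤n₁)))
  where
  ns : List ℕ
  ns = n₁ ∷ rest

  sum-reversed : ∀ f → sum (map f (reverse ns)) ≡ sum (map f ns)
  sum-reversed f = sum-↭ (↭.map⁺ f (↭-reverse ns))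

  heights≤n₁ : All (_≤ n₁) ns
  heights≤n₁ = Linked⇒All (λ b≤a c≤b → ≤-trans c≤b b≤a) ≤-refl (Linked.map <⇒≤ decreasing)
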